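{- Let $p$ be a prime and $k\ge 1$ an integer. Then $n=p^k$ is neither a strong, nor a weak, nor a very weak alpha number of order $(1,1)$.
   Context: For a positive integer $n$, $\sigma(n)=\sum_{d\mid n} d$; $\omega(n)$ is the number of distinct prime divisors of $n$; $\tau(n)$ is the number of positive divisors of $n$. A positive integer $n$ is a strong alpha number of order $(1,1)$ if there exist coprime positive integers $\alpha_1,\alpha_2$ with $\sigma(n)=\frac{\alpha_1}{\alpha_2}n$ and $2\le \max(\alpha_1,\alpha_2)\le \omega(n)$; a weak alpha number of order $(1,1)$ if there exist such coprime $\alpha_1,\alpha_2$ with $\sigma(n)=\frac{\alpha_1}{\alpha_2}n$ and $2\le \omega(n)<\max(\alpha_1,\alpha_2)\le \tau(n)$; a very weak alpha number of order $(1,1)$ if there exist such coprime $\alpha_1,\alpha_2$ with $\sigma(n)=\frac{\alpha_1}{\alpha_2}n$ and $2\le \tau(n)<\max(\alpha_1,\alpha_2)<n$. -}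

module Defs where

open import Data.Nat using (ℕ; suc; _+_; _*_; _≤_; _<_; _⊔_)
open import Data.Nat.Divisibility using (_∣_; _∣?_)
open import Data.Nat.Primality using (Prime; prime?)
open import Data.Nat.Coprimality using (Coprime)
open import Data.List using (List; filter; length; map; upTo)
open import Data.Nat.ListAction using (sum)
open import Data.Product using (Σ; _×_; ∃₂)
open import Relation.Binary.PropositionalEquality using (_≡_)
open import Relation.Nullary.Decidable using (_×-dec_)

oneTo : ℕ → List ℕ
oneTo n = map suc (upTo n)

divisors : ℕ → List ℕ
divisors n = filter (λ d → d ∣? n) (oneTo n)

σ : ℕ → ℕ
σ n = sum (divisors n)

τ : ℕ → ℕ
τ n = length (divisors n)

ω : ℕ → ℕ
ω n = length (filter (λ d → prime? d ×-dec d ∣? n) (oneTo n))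

-- σ(n) = (α₁/α₂) n with α₁, α₂ coprime positive integers, written
-- without division as α₂ · σ(n) = α₁ · n.
AlphaWitness : ℕ → ℕ → ℕ → Set
AlphaWitness n α₁ α₂ = (1 ≤ α₁) × (1 ≤ α₂) × Coprime α₁ α₂ × (α₂ * σ n ≡ α₁ * n)

StrongAlpha : ℕ → Set
StrongAlpha n = ∃₂ λ α₁ α₂ → AlphaWitness n α₁ α₂ × (2 ≤ α₁ ⊔ α₂) × (α₁ ⊔ α₂ ≤ ω n)

WeakAlpha : ℕ → Set
WeakAlpha n = ∃₂ λ α₁ α₂ → AlphaWitness n α₁ α₂ × (2 ≤ ω n) × (ω n < α₁ ⊔ α₂) × (α₁ ⊔ α₂ ≤ τ n)

VeryWeakAlpha : ℕ → Set
VeryWeakAlpha n = ∃₂ λ α₁ α₂ → AlphaWitness n α₁ α₂ × (2 ≤ τ n) × (τ n < α₁ ⊔ α₂) × (α₁ ⊔ α₂ < n)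

{-# OPTIONS --safe #-}
module Submission where

-- Every divisor d > 1 of p^k is a multiple of p, so σ(p^k) ≡ 1 (mod p) and σ(p^k) is
-- coprime to p^k. Then α₂ σ(n) = α₁ n forces σ(n) ∣ α₁, whence
-- max(α₁, α₂) ≥ σ(n) > n, while τ(n) ≤ n and ω(n) ≤ n, which rules out all three kinds of alpha number.

open import Defs
open import Data.Nat using (ℕ; zero; suc; _≤_; _<_; _^_; _+_; _*_; _⊔_; z≤n; s≤s; >-nonZero; nonTrivial⇒n>1)
open import Data.Nat.Properties
open import Data.Nat.Divisibility
open import Data.Nat.Primality using (Prime; prime⇒irreducible; prime⇒nonTrivial; prime⇒nonZero)
open import Data.Nat.Coprimality using (Coprime; coprime-divisor)
open import Data.Nat.ListAction using (sum)
open import Data.List using (List; []; _∷_; filter; length; map; upTo; applyUpTo)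
open import Data.List.Properties using (filter-accept; length-filter; length-map; length-upTo)
open import Data.List.Membership.Propositional using (_∈_)
open import Data.List.Membership.Propositional.Properties using (∈-filter⁺; ∈-map⁺; ∈-map⁻; ∈-applyUpTo⁺; ∈-applyUpTo⁻)
open import Data.List.Relation.Unary.Any using (here; there)
open import Data.Product using (_×_; _,_)
open import Data.Sum using (inj₁; inj₂)
open import Relation.Nullary using (¬_; yes; no; contradiction)
open import Relation.Unary using (Decidable)
open import Relation.Binary.PropositionalEquality using (_≡_; refl; sym; trans; cong; subst)

prime>1 : ∀ {p} → Prime p → 1 < p
prime>1 {p} pr = nonTrivial⇒n>1 p {{prime⇒nonTrivial pr}}

length-oneTo : ∀ n → length (oneTo n) ≡ n
length-oneTo n = trans (length-map suc (upTo n)) (length-upTo n)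

τ≤n : ∀ n → τ n ≤ n
τ≤n n = ≤-trans (length-filter (_∣? n) (oneTo n)) (≤-reflexive (length-oneTo n))

ω≤n : ∀ n → ω n ≤ n
ω≤n n = ≤-trans (length-filter _ (oneTo n)) (≤-reflexive (length-oneTo n))

∈⇒≤sum : ∀ {x xs} → x ∈ xs → x ≤ sum xs
∈⇒≤sum {xs = y ∷ ys} (here refl) = m≤m+n y (sum ys)
∈⇒≤sum {xs = y ∷ ys} (there x∈ys) = ≤-trans (∈⇒≤sum x∈ys) (m≤n+m (sum ys) y)

∣sum-filter : ∀ {p} {P : ℕ → Set} (P? : Decidable P) xs →
              (∀ {x} → x ∈ xs → P x → p ∣ x) → p ∣ sum (filter P? xs)
∣sum-filter P? [] _ = _ ∣0
∣sum-filter P? (x ∷ xs) p∣ with P? x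
... | yes Px = ∣m∣n⇒∣m+n (p∣ (here refl) Px) (∣sum-filter P? xs (λ y∈xs → p∣ (there y∈xs)))
... | no _ = ∣sum-filter P? xs (λ y∈xs → p∣ (there y∈xs))

-- `oneTo (suc m)` reduces to `1 ∷ map suc (applyUpTo suc m)`, so the divisor 1 splits off.
σ-suc : ∀ m → σ (suc m) ≡ 1 + sum (filter (_∣? suc m) (map suc (applyUpTo suc m)))
σ-suc m = cong sum (filter-accept (_∣? suc m) (1∣ suc m))

n<σ : ∀ {n} → 1 < n → n < σ n
n<σ {suc (suc m)} (s≤s (s≤s _)) = subst (suc (suc m) <_) (sym (σ-suc (suc m))) (s≤s (∈⇒≤sum n∈))
  where
    n∈ : suc (suc m) ∈ filter (_∣? suc (suc m)) (map suc (applyUpTo suc (suc m)))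
    n∈ = ∈-filter⁺ (_∣? suc (suc m)) (∈-map⁺ suc (∈-applyUpTo⁺ suc (n<1+n m))) ∣-refl

¬∣σ : ∀ {p n} → 1 < p → 1 ≤ n → (∀ {d} → d ∣ n → 1 < d → p ∣ d) → ¬ p ∣ σ n
¬∣σ {p} {suc m} 1<p (s≤s _) p∣divisor p∣σ = <⇒≢ 1<p (sym (∣1⇒≡1 p∣1))
  where
    rest : List ℕ
    rest = filter (_∣? suc m) (map suc (applyUpTo suc m))

    p∣rest : p ∣ sum rest
    p∣rest = ∣sum-filter (_∣? suc m) _ λ x∈ x∣n → p∣divisor x∣n (candidate>1 x∈)
      where
        candidate>1 : ∀ {x} → x ∈ map suc (applyUpTo suc m) → 1 < x
        candidate>1 x∈ with ∈-map⁻ suc x∈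
        ... | y , y∈ , refl with ∈-applyUpTo⁻ suc y∈
        ...   | _ , _ , refl = s≤s (s≤s z≤n)

    p∣1 : p ∣ 1
    p∣1 = ∣m+n∣m⇒∣n (subst (p ∣_) (trans (σ-suc m) (+-comm 1 (sum rest))) p∣σ) p∣rest

∤⇒coprime : ∀ {p d} → Prime p → ¬ p ∣ d → Coprime d p
∤⇒coprime pr p∤d (i∣d , i∣p) with prime⇒irreducible pr i∣p
... | inj₁ i≡1 = i≡1
... | inj₂ refl = contradiction i∣d p∤d

∣p^k∧∤⇒≡1 : ∀ {p d} k → Prime p → d ∣ p ^ k → ¬ p ∣ d → d ≡ 1
∣p^k∧∤⇒≡1 zero pr d∣1 _ = ∣1⇒≡1 d∣1
∣p^k∧∤⇒≡1 (suc k) pr d∣p*p^k p∤d =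
  ∣p^k∧∤⇒≡1 k pr (coprime-divisor (∤⇒coprime pr p∤d) d∣p*p^k) p∤d

∣p^k∧1<⇒p∣ : ∀ {p d} k → Prime p → d ∣ p ^ k → 1 < d → p ∣ d
∣p^k∧1<⇒p∣ {p} {d} k pr d∣p^k 1<d with p ∣? d
... | yes p∣d = p∣d
... | no p∤d = contradiction (∣p^k∧∤⇒≡1 k pr d∣p^k p∤d) (>⇒≢ 1<d)

coprime-σ[p^k] : ∀ {p} k → Prime p → Coprime (σ (p ^ k)) (p ^ k)
coprime-σ[p^k] {p} k pr {i} (i∣σ , i∣p^k) with p ∣? i
... | yes p∣i = contradiction (∣-trans p∣i i∣σ) p∤σ
  where
    p∤σ : ¬ p ∣ σ (p ^ k)
    p∤σ = ¬∣σ (prime>1 pr) (m^n>0 p {{prime⇒nonZero pr}} k) (∣p^k∧1<⇒p∣ k pr)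
... | no p∤i = ∣p^k∧∤⇒≡1 k pr i∣p^k p∤i

coprime⇒σ≤α₁ : ∀ {n α₁ α₂} → Coprime (σ n) n → AlphaWitness n α₁ α₂ → σ n ≤ α₁
coprime⇒σ≤α₁ {n} {α₁} {α₂} σ⊥n (1≤α₁ , _ , _ , α₂σ≡α₁n) =
  ∣⇒≤ {{>-nonZero 1≤α₁}} (coprime-divisor σ⊥n σ∣n*α₁)
  where
    σ∣n*α₁ : σ n ∣ n * α₁
    σ∣n*α₁ = divides α₂ (trans (*-comm n α₁) (sym α₂σ≡α₁n))

p^k<α₁⊔α₂ : ∀ {p k α₁ α₂} → Prime p → 1 ≤ k → AlphaWitness (p ^ k) α₁ α₂ → p ^ k < α₁ ⊔ α₂
p^k<α₁⊔α₂ {p} {k} {α₁} {α₂} pr 1≤k w = begin-strict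
  p ^ k     <⟨ n<σ (^-monoʳ-< p (prime>1 pr) 1≤k) ⟩
  σ (p ^ k) ≤⟨ coprime⇒σ≤α₁ (coprime-σ[p^k] k pr) w ⟩
  α₁        ≤⟨ m≤m⊔n α₁ α₂ ⟩
  α₁ ⊔ α₂   ∎
  where open ≤-Reasoning

theorem3p2 : (p k : ℕ) → Prime p → 1 ≤ k →
    ¬ StrongAlpha (p ^ k) × ¬ WeakAlpha (p ^ k) × ¬ VeryWeakAlpha (p ^ k)
theorem3p2 p k pr 1≤k =
    (λ (_ , _ , w , _ , ≤ω) → <⇒≱ (large w) (≤-trans ≤ω (ω≤n (p ^ k))))
  , (λ (_ , _ , w , _ , _ , ≤τ) → <⇒≱ (large w) (≤-trans ≤τ (τ≤n (p ^ k))))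
  , (λ (_ , _ , w , _ , _ , <n) → <-asym (large w) <n)
  where
    large : ∀ {α₁ α₂} → AlphaWitness (p ^ k) α₁ α₂ → p ^ k < α₁ ⊔ α₂
    large = p^k<α₁⊔α₂ pr 1≤k
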